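{- Let $I$ be an abelian ideal of $\Phi^+$ and $\beta_1,\beta_2,\gamma_1,\gamma_2\in I$ with $\beta_1+\beta_2=\gamma_1+\gamma_2$ and $\beta_1<\gamma_i<\beta_2$ for $i=1,2$. (1) If $\beta'_1,\beta'_2\in I$ with $\{\beta'_1,\beta'_2\}\ne\{\beta_1,\beta_2\}$, $\beta'_1+\beta'_2=\gamma_1+\gamma_2$ and $\beta'_1<\gamma_i<\beta'_2$ for $i=1,2$, then either $\beta_1<\beta'_1<\beta'_2<\beta_2$ or $\beta'_1<\beta_1<\beta_2<\beta'_2$; moreover $\beta_i-\beta'_i\in\Phi$ for $i=1,2$. (2) If $\gamma'_1,\gamma'_2\in\Phi^+$ with $\{\gamma'_1,\gamma'_2\}\neq\{\gamma_1,\gamma_2\}$, $\gamma'_1+\gamma'_2=\beta_1+\beta_2$ and $\beta_1<\gamma'_i<\beta_2$ for $i=1,2$, then $\gamma_i-\gamma'_j\in\Phi$ for all $i,j\in\{1,2\}$, and one of the following holds for some $\{i,j\}=\{1,2\}$: $\gamma'_i<\gamma_k<\gamma'_j$ for $k=1,2$, or $\gamma_i<\gamma'_k<\gamma_j$ for $k=1,2$. In particular, there is at most one pair $\{\gamma_1,\gamma_2\}$ of mutually incomparable roots with $\gamma_1+\gamma_2=\beta_1+\beta_2$ and $\beta_1<\gamma_i<\beta_2$.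
   Context: $\Phi$ is an irreducible crystallographic root system, $\Phi^+$ a positive system with simple system $\Pi$. The standard partial order: $x\le y$ iff $y-x$ is a nonnegative integer combination of $\Pi$; $x<y$ means $x\le y$, $x\neq y$. An abelian ideal of $\Phi^+$ is a subset $I\subseteq\Phi^+$ such that $\beta\in I$, $\gamma\in\Phi^+$, $\beta\le\gamma$ imply $\gamma\in I$, and $\beta+\gamma\notin\Phi$ for all $\beta,\gamma\in I$. -}

module Defs where

open import Data.Nat using (ℕ)
open import Data.Integer using (ℤ; +_; 0ℤ; _+_; _-_; _*_; -_; _<_)
open import Data.Integer.Divisibility using (_∣_)
open import Data.Fin using (Fin; _≟_)
open import Data.Vec using (Vec; []; _∷_; map; zipWith; tabulate; replicate; lookup)
open import Data.List using (List)
open import Data.List.Membership.Propositional using (_∈_)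
open import Data.Bool using (Bool; true; false; if_then_else_)
open import Data.Product using (_×_; ∃)
open import Data.Sum using (_⊎_)
open import Relation.Nullary using (¬_)
open import Relation.Nullary.Decidable using (⌊_⌋)
open import Relation.Binary.PropositionalEquality using (_≡_; _≢_)

-- Vectors of the ambient space, written in coordinates with respect to the
-- simple system Π = {α₁,…,αₙ}; α_i is the i-th standard basis vector.
V : ℕ → Set
V n = Vec ℤ n

_+ᵥ_ : ∀ {n} → V n → V n → V n
_+ᵥ_ = zipWith _+_

_-ᵥ_ : ∀ {n} → V n → V n → V n
_-ᵥ_ = zipWith _-_

_•_ : ∀ {n} → ℤ → V n → V n
k • v = map (k *_) v

negᵥ : ∀ {n} → V n → V n
negᵥ = map (λ x → - x)

zeroᵥ : ∀ {n} → V n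
zeroᵥ = replicate _ 0ℤ

sumℤ : ∀ {n} → Vec ℤ n → ℤ
sumℤ [] = 0ℤ
sumℤ (x ∷ xs) = x + sumℤ xs

simpleRoot : ∀ {n} → Fin n → V n
simpleRoot i = tabulate (λ j → if ⌊ i ≟ j ⌋ then + 1 else 0ℤ)

-- bilinear form given by the Gram matrix G (G i j = (α_i , α_j))
form : ∀ {n} → Vec (Vec ℤ n) n → V n → V n → ℤ
form G u v = sumℤ (zipWith _*_ u (map (λ row → sumℤ (zipWith _*_ row v)) G))

record RootSystem (n : ℕ) : Set where
  field
    G        : Vec (Vec ℤ n) n
    G-sym    : ∀ i j → lookup (lookup G i) j ≡ lookup (lookup G j) i
    G-posdef : ∀ v → v ≢ zeroᵥ → 0ℤ < form G v v
    roots    : List (V n)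
    nonzero  : ∀ {α} → α ∈ roots → α ≢ zeroᵥ
    reduced  : ∀ {α} (k : ℤ) → α ∈ roots → (k • α) ∈ roots → (k ≡ + 1) ⊎ (k ≡ - + 1)
    integral : ∀ {α β} → α ∈ roots → β ∈ roots → form G α α ∣ (+ 2 * form G α β)
    reflect  : ∀ {α β} (k : ℤ) → α ∈ roots → β ∈ roots →
               k * form G α α ≡ + 2 * form G α β → (β -ᵥ (k • α)) ∈ roots
    -- Π is a simple system: Π ⊆ Φ (Π is a basis of the ambient space by construction)
    -- and every root is a nonnegative or nonpositive integer combination of Π
    simple   : ∀ i → simpleRoot i ∈ roots
    sign     : ∀ {α} → α ∈ roots →
               (∃ λ (c : Vec ℕ n) → α ≡ map +_ c) ⊎ (∃ λ (c : Vec ℕ n) → negᵥ α ≡ map +_ c)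
    irreducible : ∀ (S : V n → Bool) →
      (∀ {α β} → α ∈ roots → β ∈ roots → S α ≡ true → S β ≡ false → form G α β ≡ 0ℤ) →
      (∀ {α} → α ∈ roots → S α ≡ true) ⊎ (∀ {α} → α ∈ roots → S α ≡ false)

module _ {n : ℕ} (R : RootSystem n) where
  open RootSystem R

  Φ : V n → Set
  Φ α = α ∈ roots

  Φ⁺ : V n → Set
  Φ⁺ α = Φ α × ∃ λ (c : Vec ℕ n) → α ≡ map +_ c

  _≼_ : V n → V n → Set
  x ≼ y = ∃ λ (c : Vec ℕ n) → y -ᵥ x ≡ map +_ c

  _≺_ : V n → V n → Set
  x ≺ y = x ≼ y × x ≢ y

  record AbelianIdeal (I : V n → Set) : Set where
    field
      ⊆Φ⁺     : ∀ {β} → I β → Φ⁺ β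
      upward  : ∀ {β γ} → I β → Φ⁺ γ → β ≼ γ → I γ
      abelian : ∀ {β γ} → I β → I γ → ¬ Φ (β +ᵥ γ)

PairEq : ∀ {A : Set} → A → A → A → A → Set
PairEq a b c d = (a ≡ c × b ≡ d) ⊎ (a ≡ d × b ≡ c)

-- For roots x ≠ y with (x, y) > 0 the difference x - y is again a root (a reflection produces it, unless
-- (x - y, x - y) ≤ 0). In an abelian ideal I all inner products are ≥ 0, since (x, y) < 0 would make x + y a
-- root. If a + b = c + d are two different decompositions inside I, then
-- 0 < (a - d, a - d) = (a - d, c - b) = (a, c) - (a, b) - (d, c) + (d, b) forces (a, c) > 0 or (d, b) > 0, so
-- a - c = d - b is a root and a, c are comparable; comparing a with both c and d shows that one pair lies
-- strictly between the members of the other. Part (2) applies this to the γ′ᵢ, which lie in I since they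
-- dominate β₁, and two distinct pairs of mutually incomparable roots cannot be nested.
module Submission where

open import Defs
open import Algebra.Bundles using (AbelianGroup)
open import Data.Nat as ℕ using (ℕ; zero; suc; s≤s; z≤n)
import Data.Nat.Properties as ℕ
open import Data.Nat.Divisibility as ℕ using (divides)
open import Data.Integer as ℤ using (ℤ; +_; 0ℤ; _+_; _-_; _*_; -_; _<_; _≤_; +<+; +≤+)
import Data.Integer.Properties as ℤ
open import Data.Integer.Divisibility using (_∣_)
open import Data.Integer.Tactic.RingSolver using (solve-∀)
open import Algebra.Properties.Group (AbelianGroup.group ℤ.+-0-abelianGroup) using (∙-cancelˡ)
open import Algebra.Properties.Semiring.Sum ℤ.+-*-semiring using (sum-syntax; sum-cong-≗; ∑-comm; *-distribˡ-sum)
open import Data.Fin using (Fin)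
open import Data.Vec using (Vec; []; _∷_; map; zipWith; lookup)
open import Data.Vec.Properties using (∷-injectiveˡ; ∷-injectiveʳ; zipWith-comm; lookup-map; ≡-dec)
open import Data.Product using (_×_; _,_; proj₁; proj₂)
open import Data.Sum as Sum using (_⊎_; inj₁; inj₂; [_,_])
open import Data.Empty using (⊥-elim)
open import Function using (_∘_)
open import Relation.Nullary using (¬_; Dec; yes; no)
open import Relation.Nullary.Decidable using (_×-dec_; _⊎-dec_; decidable-stable)
open import Relation.Binary.Definitions using (DecidableEquality)
open import Relation.Binary.PropositionalEquality using (_≡_; _≢_; refl; sym; trans; cong; cong₂; subst; module ≡-Reasoning)

private
  variable
    n : ℕ
    a b c d x y z : V n

m∣2*n⇒m≡2*n⊎m≤n : ∀ {m n} → 0 ℕ.< n → m ℕ.∣ 2 ℕ.* n → m ≡ 2 ℕ.* n ⊎ m ℕ.≤ n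
m∣2*n⇒m≡2*n⊎m≤n (s≤s _) (divides zero ())
m∣2*n⇒m≡2*n⊎m≤n {m} _ (divides (suc zero) 2n≡m+0) = inj₁ (sym (trans 2n≡m+0 (ℕ.+-identityʳ m)))
m∣2*n⇒m≡2*n⊎m≤n {m} _ (divides (suc (suc k)) 2n≡[2+k]m) =
  inj₂ (ℕ.*-cancelˡ-≤ 2 (subst (2 ℕ.* m ℕ.≤_) (sym 2n≡[2+k]m) (ℕ.+-monoʳ-≤ m (ℕ.+-monoʳ-≤ m z≤n))))

i∣2*j⇒i≡2*j⊎i≤j : ∀ {i j} → 0ℤ < i → 0ℤ < j → i ∣ + 2 * j → i ≡ + 2 * j ⊎ i ≤ j
i∣2*j⇒i≡2*j⊎i≤j {+ m} {+ n} _ (+<+ 0<n) i∣2j =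
  Sum.map (λ m≡2n → trans (cong +_ m≡2n) (ℤ.pos-* 2 n)) +≤+
      (m∣2*n⇒m≡2*n⊎m≤n 0<n (subst (m ℕ.∣_) (cong ℤ.∣_∣ (sym (ℤ.pos-* 2 n))) i∣2j))

[i-j]-[k-l]≤0 : ∀ {i j k l : ℤ} → i ≤ j → l ≤ k → (i - j) - (k - l) ≤ 0ℤ
[i-j]-[k-l]≤0 i≤j l≤k = ℤ.i≤j⇒i-j≤0 (ℤ.≤-trans (ℤ.i≤j⇒i-j≤0 i≤j) (ℤ.i≤j⇒0≤j-i l≤k))

0<[i-j]-[k-l]⇒0<i⊎0<l : ∀ {i j k l : ℤ} → 0ℤ < (i - j) - (k - l) → 0ℤ ≤ j → 0ℤ ≤ k → 0ℤ < i ⊎ 0ℤ < l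
0<[i-j]-[k-l]⇒0<i⊎0<l {i} {l = l} 0<[i-j]-[k-l] 0≤j 0≤k with 0ℤ ℤ.<? i | 0ℤ ℤ.<? l
... | yes 0<i | _       = inj₁ 0<i
... | no _    | yes 0<l = inj₂ 0<l
... | no 0≮i  | no 0≮l  =
  ⊥-elim (ℤ.≤⇒≯ ([i-j]-[k-l]≤0 (ℤ.≤-trans (ℤ.≮⇒≥ 0≮i) 0≤j) (ℤ.≤-trans (ℤ.≮⇒≥ 0≮l) 0≤k)) 0<[i-j]-[k-l])

+ᵥ-comm : (x y : V n) → x +ᵥ y ≡ y +ᵥ x
+ᵥ-comm = zipWith-comm ℤ.+-comm

+ᵥ-cancelˡ : ∀ (x : V n) {y z} → x +ᵥ y ≡ x +ᵥ z → y ≡ z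
+ᵥ-cancelˡ [] {[]} {[]} _ = refl
+ᵥ-cancelˡ (i ∷ x) {j ∷ y} {k ∷ z} e =
  cong₂ _∷_ (∙-cancelˡ i j k (∷-injectiveˡ e)) (+ᵥ-cancelˡ x (∷-injectiveʳ e))

+ᵥ-cancelʳ : ∀ (y : V n) {x z} → x +ᵥ y ≡ z +ᵥ y → x ≡ z
+ᵥ-cancelʳ y {x} {z} e = +ᵥ-cancelˡ y (trans (+ᵥ-comm y x) (trans e (+ᵥ-comm z y)))

x-ᵥy≡0⇒x≡y : (x y : V n) → x -ᵥ y ≡ zeroᵥ → x ≡ y
x-ᵥy≡0⇒x≡y [] [] _ = refl
x-ᵥy≡0⇒x≡y (i ∷ x) (j ∷ y) e =
  cong₂ _∷_ (ℤ.i-j≡0⇒i≡j i j (∷-injectiveˡ e)) (x-ᵥy≡0⇒x≡y x y (∷-injectiveʳ e))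

negᵥ[x-ᵥy]≡y-ᵥx : (x y : V n) → negᵥ (x -ᵥ y) ≡ y -ᵥ x
negᵥ[x-ᵥy]≡y-ᵥx [] [] = refl
negᵥ[x-ᵥy]≡y-ᵥx (i ∷ x) (j ∷ y) = cong₂ _∷_ (-[i-j]≡j-i i j) (negᵥ[x-ᵥy]≡y-ᵥx x y)
  where
  -[i-j]≡j-i : ∀ i j → - (i - j) ≡ j - i
  -[i-j]≡j-i = solve-∀

x-ᵥnegᵥy≡x+ᵥy : (x y : V n) → x -ᵥ negᵥ y ≡ x +ᵥ y
x-ᵥnegᵥy≡x+ᵥy [] [] = refl
x-ᵥnegᵥy≡x+ᵥy (i ∷ x) (j ∷ y) = cong₂ _∷_ (i-[-j]≡i+j i j) (x-ᵥnegᵥy≡x+ᵥy x y)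
  where
  i-[-j]≡i+j : ∀ i j → i - (- j) ≡ i + j
  i-[-j]≡i+j = solve-∀

x-ᵥ2•x≡negᵥx : (x : V n) → x -ᵥ ((+ 2) • x) ≡ negᵥ x
x-ᵥ2•x≡negᵥx [] = refl
x-ᵥ2•x≡negᵥx (i ∷ x) = cong₂ _∷_ (i-2i≡-i i) (x-ᵥ2•x≡negᵥx x)
  where
  i-2i≡-i : ∀ i → i - (+ 2 * i) ≡ - i
  i-2i≡-i = solve-∀

x-ᵥ1•y≡x-ᵥy : (x y : V n) → x -ᵥ ((+ 1) • y) ≡ x -ᵥ y
x-ᵥ1•y≡x-ᵥy [] [] = refl
x-ᵥ1•y≡x-ᵥy (i ∷ x) (j ∷ y) = cong₂ _∷_ (cong (λ k → i - k) (ℤ.*-identityˡ j)) (x-ᵥ1•y≡x-ᵥy x y)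

+ᵥ-exchange : ∀ (a b c d : V n) → a +ᵥ b ≡ c +ᵥ d → a -ᵥ c ≡ d -ᵥ b
+ᵥ-exchange [] [] [] [] _ = refl
+ᵥ-exchange (i ∷ a) (j ∷ b) (k ∷ c) (l ∷ d) e =
  cong₂ _∷_ (exchange (∷-injectiveˡ e)) (+ᵥ-exchange a b c d (∷-injectiveʳ e))
  where
  open ≡-Reasoning
  shift : ∀ i j k → i - k ≡ (i + j) - (k + j)
  shift = solve-∀
  unshift : ∀ k l j → (k + l) - (k + j) ≡ l - j
  unshift = solve-∀
  exchange : i + j ≡ k + l → i - k ≡ l - j
  exchange i+j≡k+l = begin
    i - k             ≡⟨ shift i j k ⟩
    (i + j) - (k + j) ≡⟨ cong (_- (k + j)) i+j≡k+l ⟩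
    (k + l) - (k + j) ≡⟨ unshift k l j ⟩
    l - j             ∎

+ᵥ-minus-telescope : (x y z : V n) → (x -ᵥ y) +ᵥ (y -ᵥ z) ≡ x -ᵥ z
+ᵥ-minus-telescope [] [] [] = refl
+ᵥ-minus-telescope (i ∷ x) (j ∷ y) (k ∷ z) =
  cong₂ _∷_ (ℤ.+-minus-telescope i j k) (+ᵥ-minus-telescope x y z)

map+-zipWith-+ : (c d : Vec ℕ n) → map +_ (zipWith ℕ._+_ c d) ≡ map +_ c +ᵥ map +_ d
map+-zipWith-+ [] [] = refl
map+-zipWith-+ (i ∷ c) (j ∷ d) = cong₂ _∷_ (ℤ.pos-+ i j) (map+-zipWith-+ c d)

map+c≡negᵥmap+d⇒map+c≡0 : (c d : Vec ℕ n) → map +_ c ≡ negᵥ (map +_ d) → map +_ c ≡ zeroᵥ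
map+c≡negᵥmap+d⇒map+c≡0 [] [] _ = refl
map+c≡negᵥmap+d⇒map+c≡0 (i ∷ c) (j ∷ d) e =
  cong₂ _∷_ (+i≡-+j⇒+i≡0 i j (∷-injectiveˡ e)) (map+c≡negᵥmap+d⇒map+c≡0 c d (∷-injectiveʳ e))
  where
  +i≡-+j⇒+i≡0 : ∀ i j → + i ≡ - + j → + i ≡ 0ℤ
  +i≡-+j⇒+i≡0 zero    _       _  = refl
  +i≡-+j⇒+i≡0 (suc i) zero    ()
  +i≡-+j⇒+i≡0 (suc i) (suc j) ()

dot : V n → V n → ℤ
dot u w = sumℤ (zipWith _*_ u w)

dot-subˡ : (u u′ w : V n) → dot (u -ᵥ u′) w ≡ dot u w - dot u′ w
dot-subˡ [] [] [] = refl
dot-subˡ (i ∷ u) (i′ ∷ u′) (k ∷ w) =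
  trans (cong (_+_ ((i - i′) * k)) (dot-subˡ u u′ w)) (distrib i i′ k (dot u w) (dot u′ w))
  where
  distrib : ∀ i i′ k s s′ → (i - i′) * k + (s - s′) ≡ (i * k + s) - (i′ * k + s′)
  distrib = solve-∀

dot-negˡ : (u w : V n) → dot (negᵥ u) w ≡ - dot u w
dot-negˡ [] [] = refl
dot-negˡ (i ∷ u) (k ∷ w) =
  trans (cong (_+_ (- i * k)) (dot-negˡ u w)) (distrib i k (dot u w))
  where
  distrib : ∀ i k s → - i * k + - s ≡ - (i * k + s)
  distrib = solve-∀

dot≡∑ : (u w : V n) → dot u w ≡ ∑[ i < n ] (lookup u i * lookup w i)
dot≡∑ [] [] = refl
dot≡∑ (i ∷ u) (k ∷ w) = cong (_+_ (i * k)) (dot≡∑ u w)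

form-subˡ : (G : Vec (Vec ℤ n) n) (u u′ w : V n) → form G (u -ᵥ u′) w ≡ form G u w - form G u′ w
form-subˡ G u u′ w = dot-subˡ u u′ _

form-negˡ : (G : Vec (Vec ℤ n) n) (u w : V n) → form G (negᵥ u) w ≡ - form G u w
form-negˡ G u w = dot-negˡ u _

form≡∑∑ : (G : Vec (Vec ℤ n) n) (u v : V n) →
          form G u v ≡ ∑[ i < n ] ∑[ j < n ] (lookup u i * (lookup (lookup G i) j * lookup v j))
form≡∑∑ {n} G u v = trans (dot≡∑ u Gv) (sum-cong-≗ row)
  where
  open ≡-Reasoning
  Gv = map (λ Gᵢ → dot Gᵢ v) G
  row : ∀ i → lookup u i * lookup Gv i ≡ ∑[ j < n ] (lookup u i * (lookup (lookup G i) j * lookup v j))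
  row i = begin
    lookup u i * lookup Gv i
      ≡⟨ cong (lookup u i *_) (trans (lookup-map i _ G) (dot≡∑ (lookup G i) v)) ⟩
    lookup u i * (∑[ j < n ] (lookup (lookup G i) j * lookup v j))
      ≡⟨ *-distribˡ-sum (lookup u i) (λ j → lookup (lookup G i) j * lookup v j) ⟩
    ∑[ j < n ] (lookup u i * (lookup (lookup G i) j * lookup v j)) ∎

form-comm : (G : Vec (Vec ℤ n) n) → (∀ i j → lookup (lookup G i) j ≡ lookup (lookup G j) i) →
            (u v : V n) → form G u v ≡ form G v u
form-comm {n} G G-sym u v = begin
  form G u v                          ≡⟨ form≡∑∑ G u v ⟩
  ∑[ i < n ] ∑[ j < n ] term u v i j  ≡⟨ ∑-comm (term u v) ⟩
  ∑[ j < n ] ∑[ i < n ] term u v i j  ≡⟨ sum-cong-≗ (λ j → sum-cong-≗ (λ i → term-swap i j)) ⟩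
  ∑[ j < n ] ∑[ i < n ] term v u j i  ≡⟨ form≡∑∑ G v u ⟨
  form G v u                          ∎
  where
  open ≡-Reasoning
  term : V n → V n → Fin n → Fin n → ℤ
  term u v i j = lookup u i * (lookup (lookup G i) j * lookup v j)
  rearrange : ∀ p g q → p * (g * q) ≡ q * (g * p)
  rearrange = solve-∀
  term-swap : ∀ i j → term u v i j ≡ term v u j i
  term-swap i j = trans (cong (λ g → lookup u i * (g * lookup v j)) (G-sym i j))
                        (rearrange (lookup u i) (lookup (lookup G j) i) (lookup v j))

distinct-sum-pairs⇒≢ : a +ᵥ b ≡ c +ᵥ d → ¬ PairEq a b c d → a ≢ c
distinct-sum-pairs⇒≢ {a = a} a+b≡a+d ne refl = ne (inj₁ (refl , +ᵥ-cancelˡ a a+b≡a+d))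

module _ {A : Set} {a b c d : A} where

  PairEq-sym : PairEq a b c d → PairEq c d a b
  PairEq-sym (inj₁ (a≡c , b≡d)) = inj₁ (sym a≡c , sym b≡d)
  PairEq-sym (inj₂ (a≡d , b≡c)) = inj₂ (sym b≡c , sym a≡d)

  PairEq-swapˡ : PairEq a b c d → PairEq b a c d
  PairEq-swapˡ (inj₁ (a≡c , b≡d)) = inj₂ (b≡d , a≡c)
  PairEq-swapˡ (inj₂ (a≡d , b≡c)) = inj₁ (b≡c , a≡d)

  PairEq-swapʳ : PairEq a b c d → PairEq a b d c
  PairEq-swapʳ (inj₁ (a≡c , b≡d)) = inj₂ (a≡c , b≡d)
  PairEq-swapʳ (inj₂ (a≡d , b≡c)) = inj₁ (a≡d , b≡c)

PairEq? : ∀ {A : Set} → DecidableEquality A → (a b c d : A) → Dec (PairEq a b c d)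
PairEq? _≟_ a b c d = (a ≟ c ×-dec b ≟ d) ⊎-dec (a ≟ d ×-dec b ≟ c)

module _ (R : RootSystem n) where
  open RootSystem R

  ⟪_,_⟫ : V n → V n → ℤ
  ⟪ u , v ⟫ = form G u v

  ⟪⟫-comm : ∀ u v → ⟪ u , v ⟫ ≡ ⟪ v , u ⟫
  ⟪⟫-comm = form-comm G G-sym

  ⟪⟫-negʳ : ∀ u v → ⟪ u , negᵥ v ⟫ ≡ - ⟪ u , v ⟫
  ⟪⟫-negʳ u v = trans (⟪⟫-comm u (negᵥ v)) (trans (form-negˡ G v u) (cong -_ (⟪⟫-comm v u)))

  ⟪⟫-subʳ : ∀ u v w → ⟪ u , v -ᵥ w ⟫ ≡ ⟪ u , v ⟫ - ⟪ u , w ⟫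
  ⟪⟫-subʳ u v w =
    trans (⟪⟫-comm u (v -ᵥ w)) (trans (form-subˡ G v w u) (cong₂ _-_ (⟪⟫-comm v u) (⟪⟫-comm w u)))

  ⟪a-ᵥb,c-ᵥd⟫ : ∀ a b c d → ⟪ a -ᵥ b , c -ᵥ d ⟫ ≡ (⟪ a , c ⟫ - ⟪ a , d ⟫) - (⟪ b , c ⟫ - ⟪ b , d ⟫)
  ⟪a-ᵥb,c-ᵥd⟫ a b c d = trans (form-subˡ G a b (c -ᵥ d)) (cong₂ _-_ (⟪⟫-subʳ a c d) (⟪⟫-subʳ b c d))

  ⟪x-ᵥy,x-ᵥy⟫>0 : x ≢ y → 0ℤ < ⟪ x -ᵥ y , x -ᵥ y ⟫
  ⟪x-ᵥy,x-ᵥy⟫>0 {x} {y} x≢y = G-posdef (x -ᵥ y) (x≢y ∘ x-ᵥy≡0⇒x≡y x y)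

  Φ-negᵥ : Φ R x → Φ R (negᵥ x)
  Φ-negᵥ {x} x∈Φ = subst (Φ R) (x-ᵥ2•x≡negᵥx x) (reflect (+ 2) x∈Φ x∈Φ refl)

  Φ-flip : Φ R (x -ᵥ y) → Φ R (y -ᵥ x)
  Φ-flip {x} {y} x-y∈Φ = subst (Φ R) (negᵥ[x-ᵥy]≡y-ᵥx x y) (Φ-negᵥ x-y∈Φ)

  reflect-unit : Φ R x → Φ R y → ⟪ x , x ⟫ ≡ + 2 * ⟪ x , y ⟫ → Φ R (y -ᵥ x)
  reflect-unit {x} {y} x∈Φ y∈Φ xx≡2xy =
    subst (Φ R) (x-ᵥ1•y≡x-ᵥy y x) (reflect (+ 1) x∈Φ y∈Φ (trans (ℤ.*-identityˡ _) xx≡2xy))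

  -- Integrality forces 2(x,y)/(x,x) = 1 or (x,x) ≤ (x,y), and likewise with x, y exchanged; in the first two
  -- cases a reflection produces the difference, and the last one would make (x - y, x - y) ≤ 0.
  acute⇒x-ᵥy∈Φ : Φ R x → Φ R y → 0ℤ < ⟪ x , y ⟫ → x ≢ y → Φ R (x -ᵥ y)
  acute⇒x-ᵥy∈Φ {x} {y} x∈Φ y∈Φ 0<xy x≢y =
    cases (i∣2*j⇒i≡2*j⊎i≤j (G-posdef x (nonzero x∈Φ)) 0<xy (integral x∈Φ y∈Φ))
          (i∣2*j⇒i≡2*j⊎i≤j (G-posdef y (nonzero y∈Φ)) (subst (0ℤ <_) (⟪⟫-comm x y) 0<xy) (integral y∈Φ x∈Φ))
    where
    cases : ⟪ x , x ⟫ ≡ + 2 * ⟪ x , y ⟫ ⊎ ⟪ x , x ⟫ ≤ ⟪ x , y ⟫ →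
            ⟪ y , y ⟫ ≡ + 2 * ⟪ y , x ⟫ ⊎ ⟪ y , y ⟫ ≤ ⟪ y , x ⟫ → Φ R (x -ᵥ y)
    cases (inj₁ xx≡2xy) _              = Φ-flip (reflect-unit x∈Φ y∈Φ xx≡2xy)
    cases (inj₂ _)      (inj₁ yy≡2yx) = reflect-unit y∈Φ x∈Φ yy≡2yx
    cases (inj₂ xx≤xy)  (inj₂ yy≤yx)  = ⊥-elim (ℤ.≤⇒≯ |x-y|²≤0 (⟪x-ᵥy,x-ᵥy⟫>0 x≢y))
      where
      |x-y|²≤0 : ⟪ x -ᵥ y , x -ᵥ y ⟫ ≤ 0ℤ
      |x-y|²≤0 = subst (_≤ 0ℤ) (sym (⟪a-ᵥb,c-ᵥd⟫ x y x y)) ([i-j]-[k-l]≤0 xx≤xy yy≤yx)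

  obtuse⇒x+ᵥy∈Φ : Φ R x → Φ R y → ⟪ x , y ⟫ < 0ℤ → x ≢ negᵥ y → Φ R (x +ᵥ y)
  obtuse⇒x+ᵥy∈Φ {x} {y} x∈Φ y∈Φ xy<0 x≢-y = subst (Φ R) (x-ᵥnegᵥy≡x+ᵥy x y)
    (acute⇒x-ᵥy∈Φ x∈Φ (Φ-negᵥ y∈Φ) (subst (0ℤ <_) (sym (⟪⟫-negʳ x y)) (ℤ.neg-mono-< xy<0)) x≢-y)

  Φ⁺-≢-negᵥ : Φ⁺ R x → Φ⁺ R y → x ≢ negᵥ y
  Φ⁺-≢-negᵥ (x∈Φ , c , refl) (_ , d , refl) x≡-y = nonzero x∈Φ (map+c≡negᵥmap+d⇒map+c≡0 c d x≡-y)

  ≼-trans : _≼_ R x y → _≼_ R y z → _≼_ R x z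
  ≼-trans {x} {y} {z} (c , y-x≡c) (d , z-y≡d) = zipWith ℕ._+_ d c , (begin
    z -ᵥ x                      ≡⟨ +ᵥ-minus-telescope z y x ⟨
    (z -ᵥ y) +ᵥ (y -ᵥ x)        ≡⟨ cong₂ _+ᵥ_ z-y≡d y-x≡c ⟩
    map +_ d +ᵥ map +_ c        ≡⟨ map+-zipWith-+ d c ⟨
    map +_ (zipWith ℕ._+_ d c)  ∎)
    where open ≡-Reasoning

  ≼-antisym : _≼_ R x y → _≼_ R y x → x ≡ y
  ≼-antisym {x} {y} (c , y-x≡c) (d , x-y≡d) =
    sym (x-ᵥy≡0⇒x≡y y x (trans y-x≡c (map+c≡negᵥmap+d⇒map+c≡0 c d c≡-d)))
    where
    c≡-d : map +_ c ≡ negᵥ (map +_ d)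
    c≡-d = trans (sym y-x≡c) (trans (sym (negᵥ[x-ᵥy]≡y-ᵥx x y)) (cong negᵥ x-y≡d))

  ≺-trans : _≺_ R x y → _≺_ R y z → _≺_ R x z
  ≺-trans (x≼y , x≢y) (y≼z , _) = ≼-trans x≼y y≼z , λ { refl → x≢y (≼-antisym x≼y y≼z) }

  ≺-flip : a +ᵥ b ≡ c +ᵥ d → _≺_ R c a → _≺_ R b d
  ≺-flip {a} {b} {c} {d} a+b≡c+d ((k , a-c≡k) , c≢a) =
    (k , trans (sym (+ᵥ-exchange a b c d a+b≡c+d)) a-c≡k) ,
    λ { refl → c≢a (sym (+ᵥ-cancelʳ b a+b≡c+d)) }

  Φ-difference⇒≺-total : Φ R (x -ᵥ y) → x ≢ y → _≺_ R y x ⊎ _≺_ R x y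
  Φ-difference⇒≺-total {x} {y} x-y∈Φ x≢y with sign x-y∈Φ
  ... | inj₁ (c , x-y≡c)  = inj₁ ((c , x-y≡c) , x≢y ∘ sym)
  ... | inj₂ (c , -[x-y]≡c) = inj₂ ((c , trans (sym (negᵥ[x-ᵥy]≡y-ᵥx x y)) -[x-y]≡c) , x≢y)

  Inside : V n → V n → V n → V n → Set
  Inside x y a b = (_≺_ R a x × _≺_ R x b) × (_≺_ R a y × _≺_ R y b)

  Inside⇒≼ : Inside x y a b → _≼_ R a b
  Inside⇒≼ ((a≺x , x≺b) , _) = proj₁ (≺-trans a≺x x≺b)

  same-sum-root-differences⇒nested : a +ᵥ b ≡ c +ᵥ d → ¬ PairEq a b c d → Φ R (a -ᵥ c) → Φ R (a -ᵥ d) →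
    Inside a b c d ⊎ Inside a b d c ⊎ Inside c d a b ⊎ Inside c d b a
  same-sum-root-differences⇒nested {a} {b} {c} {d} a+b≡c+d ne a-c∈Φ a-d∈Φ =
    nest (Φ-difference⇒≺-total a-c∈Φ (distinct-sum-pairs⇒≢ a+b≡c+d ne))
         (Φ-difference⇒≺-total a-d∈Φ (distinct-sum-pairs⇒≢ a+b≡d+c (ne ∘ PairEq-swapʳ)))
    where
    a+b≡d+c = trans a+b≡c+d (+ᵥ-comm c d)
    nest : _≺_ R c a ⊎ _≺_ R a c → _≺_ R d a ⊎ _≺_ R a d →
      Inside a b c d ⊎ Inside a b d c ⊎ Inside c d a b ⊎ Inside c d b a
    nest (inj₁ c≺a) (inj₁ d≺a) =
      inj₂ (inj₂ (inj₂ ((≺-flip a+b≡d+c d≺a , c≺a) , (≺-flip a+b≡c+d c≺a , d≺a))))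
    nest (inj₁ c≺a) (inj₂ a≺d) =
      inj₁ ((c≺a , a≺d) , (≺-flip (sym a+b≡d+c) a≺d , ≺-flip a+b≡c+d c≺a))
    nest (inj₂ a≺c) (inj₁ d≺a) =
      inj₂ (inj₁ ((d≺a , a≺c) , (≺-flip (sym a+b≡c+d) a≺c , ≺-flip a+b≡d+c d≺a)))
    nest (inj₂ a≺c) (inj₂ a≺d) =
      inj₂ (inj₂ (inj₁ ((a≺c , ≺-flip (sym a+b≡d+c) a≺d) , (a≺d , ≺-flip (sym a+b≡c+d) a≺c))))

  module _ {I : V n → Set} (AI : AbelianIdeal R I) where
    open AbelianIdeal AI

    ideal⊆Φ : I x → Φ R x
    ideal⊆Φ = proj₁ ∘ ⊆Φ⁺

    ideal⇒⟪⟫≥0 : I x → I y → 0ℤ ≤ ⟪ x , y ⟫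
    ideal⇒⟪⟫≥0 x∈I y∈I = ℤ.≮⇒≥ λ xy<0 →
      abelian x∈I y∈I (obtuse⇒x+ᵥy∈Φ (ideal⊆Φ x∈I) (ideal⊆Φ y∈I) xy<0 (Φ⁺-≢-negᵥ (⊆Φ⁺ x∈I) (⊆Φ⁺ y∈I)))

    same-sum⇒a-ᵥc∈Φ : I a → I b → I c → I d → a +ᵥ b ≡ c +ᵥ d → ¬ PairEq a b c d → Φ R (a -ᵥ c)
    same-sum⇒a-ᵥc∈Φ {a} {b} {c} {d} a∈I b∈I c∈I d∈I a+b≡c+d ne =
      [ (λ 0<ac → acute⇒x-ᵥy∈Φ (ideal⊆Φ a∈I) (ideal⊆Φ c∈I) 0<ac (distinct-sum-pairs⇒≢ a+b≡c+d ne))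
      , (λ 0<db → subst (Φ R) (sym (+ᵥ-exchange a b c d a+b≡c+d))
                    (acute⇒x-ᵥy∈Φ (ideal⊆Φ d∈I) (ideal⊆Φ b∈I) 0<db (b≢d ∘ sym)))
      ] (0<[i-j]-[k-l]⇒0<i⊎0<l 0<[ac-ab]-[dc-db] (ideal⇒⟪⟫≥0 a∈I b∈I) (ideal⇒⟪⟫≥0 d∈I c∈I))
      where
      a+b≡d+c = trans a+b≡c+d (+ᵥ-comm c d)
      b≢d : b ≢ d
      b≢d = distinct-sum-pairs⇒≢ (trans (+ᵥ-comm b a) a+b≡d+c) (ne ∘ PairEq-swapˡ ∘ PairEq-swapʳ)
      0<[ac-ab]-[dc-db] : 0ℤ < (⟪ a , c ⟫ - ⟪ a , b ⟫) - (⟪ d , c ⟫ - ⟪ d , b ⟫)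
      0<[ac-ab]-[dc-db] = subst (0ℤ <_) (trans (cong (λ v → ⟪ a -ᵥ d , v ⟫) (+ᵥ-exchange a b d c a+b≡d+c))
                                              (⟪a-ᵥb,c-ᵥd⟫ a d c b))
                                (⟪x-ᵥy,x-ᵥy⟫>0 (distinct-sum-pairs⇒≢ a+b≡d+c (ne ∘ PairEq-swapʳ)))

    same-sum-ordered-pairs-nested : I a → I b → I c → I d → a +ᵥ b ≡ c +ᵥ d → ¬ PairEq a b c d →
      _≺_ R a b → _≺_ R c d →
      ((_≺_ R a c × _≺_ R c d × _≺_ R d b) ⊎ (_≺_ R c a × _≺_ R a b × _≺_ R b d))
      × Φ R (a -ᵥ c) × Φ R (b -ᵥ d)
    same-sum-ordered-pairs-nested {a} {b} {c} {d} a∈I b∈I c∈I d∈I a+b≡c+d ne a≺b c≺d =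
      order (Φ-difference⇒≺-total a-c∈Φ (distinct-sum-pairs⇒≢ a+b≡c+d ne)) , a-c∈Φ ,
      same-sum⇒a-ᵥc∈Φ b∈I a∈I d∈I c∈I (trans (+ᵥ-comm b a) (trans a+b≡c+d (+ᵥ-comm c d)))
                      (ne ∘ PairEq-swapˡ ∘ PairEq-swapʳ)
      where
      a-c∈Φ = same-sum⇒a-ᵥc∈Φ a∈I b∈I c∈I d∈I a+b≡c+d ne
      order : _≺_ R c a ⊎ _≺_ R a c →
              (_≺_ R a c × _≺_ R c d × _≺_ R d b) ⊎ (_≺_ R c a × _≺_ R a b × _≺_ R b d)
      order (inj₁ c≺a) = inj₂ (c≺a , a≺b , ≺-flip a+b≡c+d c≺a)
      order (inj₂ a≺c) = inj₁ (a≺c , c≺d , ≺-flip (sym a+b≡c+d) a≺c)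

    same-sum-pairs-nested : I a → I b → I c → I d → a +ᵥ b ≡ c +ᵥ d → ¬ PairEq a b c d →
      (Φ R (a -ᵥ c) × Φ R (a -ᵥ d) × Φ R (b -ᵥ c) × Φ R (b -ᵥ d))
      × (Inside a b c d ⊎ Inside a b d c ⊎ Inside c d a b ⊎ Inside c d b a)
    same-sum-pairs-nested {a} {b} {c} {d} a∈I b∈I c∈I d∈I a+b≡c+d ne =
      (a-c∈Φ , a-d∈Φ , b-c∈Φ , b-d∈Φ) , same-sum-root-differences⇒nested a+b≡c+d ne a-c∈Φ a-d∈Φ
      where
      a+b≡d+c = trans a+b≡c+d (+ᵥ-comm c d)
      a-c∈Φ = same-sum⇒a-ᵥc∈Φ a∈I b∈I c∈I d∈I a+b≡c+d ne
      a-d∈Φ = same-sum⇒a-ᵥc∈Φ a∈I b∈I d∈I c∈I a+b≡d+c (ne ∘ PairEq-swapʳ)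
      b-c∈Φ = same-sum⇒a-ᵥc∈Φ b∈I a∈I c∈I d∈I (trans (+ᵥ-comm b a) a+b≡c+d) (ne ∘ PairEq-swapˡ)
      b-d∈Φ = same-sum⇒a-ᵥc∈Φ b∈I a∈I d∈I c∈I (trans (+ᵥ-comm b a) a+b≡d+c)
                              (ne ∘ PairEq-swapˡ ∘ PairEq-swapʳ)

    same-sum-incomparable-pairs-equal : I a → I b → I c → I d →
      ¬ _≼_ R a b → ¬ _≼_ R b a → ¬ _≼_ R c d → ¬ _≼_ R d c → a +ᵥ b ≡ c +ᵥ d → PairEq a b c d
    same-sum-incomparable-pairs-equal {a} {b} {c} {d} a∈I b∈I c∈I d∈I a⋠b b⋠a c⋠d d⋠c a+b≡c+d =
      decidable-stable (PairEq? (≡-dec ℤ._≟_) a b c d) λ ne →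
        [ c⋠d ∘ Inside⇒≼ , [ d⋠c ∘ Inside⇒≼ , [ a⋠b ∘ Inside⇒≼ , b⋠a ∘ Inside⇒≼ ] ] ]
        (proj₂ (same-sum-pairs-nested a∈I b∈I c∈I d∈I a+b≡c+d ne))

corollary4p6 : ∀ {n} (R : RootSystem n) (I : V n → Set) → AbelianIdeal R I →
  ∀ β₁ β₂ γ₁ γ₂ → I β₁ → I β₂ → I γ₁ → I γ₂ →
  β₁ +ᵥ β₂ ≡ γ₁ +ᵥ γ₂ →
  _≺_ R β₁ γ₁ → _≺_ R γ₁ β₂ → _≺_ R β₁ γ₂ → _≺_ R γ₂ β₂ →
  (∀ β₁′ β₂′ → I β₁′ → I β₂′ → ¬ PairEq β₁′ β₂′ β₁ β₂ →
    β₁′ +ᵥ β₂′ ≡ γ₁ +ᵥ γ₂ →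
    _≺_ R β₁′ γ₁ → _≺_ R γ₁ β₂′ → _≺_ R β₁′ γ₂ → _≺_ R γ₂ β₂′ →
    ((_≺_ R β₁ β₁′ × _≺_ R β₁′ β₂′ × _≺_ R β₂′ β₂)
      ⊎ (_≺_ R β₁′ β₁ × _≺_ R β₁ β₂ × _≺_ R β₂ β₂′))
    × Φ R (β₁ -ᵥ β₁′) × Φ R (β₂ -ᵥ β₂′))
  × (∀ γ₁′ γ₂′ → Φ⁺ R γ₁′ → Φ⁺ R γ₂′ → ¬ PairEq γ₁′ γ₂′ γ₁ γ₂ →
    γ₁′ +ᵥ γ₂′ ≡ β₁ +ᵥ β₂ →
    _≺_ R β₁ γ₁′ → _≺_ R γ₁′ β₂ → _≺_ R β₁ γ₂′ → _≺_ R γ₂′ β₂ →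
    (Φ R (γ₁ -ᵥ γ₁′) × Φ R (γ₁ -ᵥ γ₂′) × Φ R (γ₂ -ᵥ γ₁′) × Φ R (γ₂ -ᵥ γ₂′))
    × (((_≺_ R γ₁′ γ₁ × _≺_ R γ₁ γ₂′) × (_≺_ R γ₁′ γ₂ × _≺_ R γ₂ γ₂′))
      ⊎ ((_≺_ R γ₂′ γ₁ × _≺_ R γ₁ γ₁′) × (_≺_ R γ₂′ γ₂ × _≺_ R γ₂ γ₁′))
      ⊎ ((_≺_ R γ₁ γ₁′ × _≺_ R γ₁′ γ₂) × (_≺_ R γ₁ γ₂′ × _≺_ R γ₂′ γ₂))
      ⊎ ((_≺_ R γ₂ γ₁′ × _≺_ R γ₁′ γ₁) × (_≺_ R γ₂ γ₂′ × _≺_ R γ₂′ γ₁))))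
  × (∀ δ₁ δ₂ δ₁′ δ₂′ → Φ⁺ R δ₁ → Φ⁺ R δ₂ → Φ⁺ R δ₁′ → Φ⁺ R δ₂′ →
    ¬ _≼_ R δ₁ δ₂ → ¬ _≼_ R δ₂ δ₁ → ¬ _≼_ R δ₁′ δ₂′ → ¬ _≼_ R δ₂′ δ₁′ →
    δ₁ +ᵥ δ₂ ≡ β₁ +ᵥ β₂ → δ₁′ +ᵥ δ₂′ ≡ β₁ +ᵥ β₂ →
    _≺_ R β₁ δ₁ → _≺_ R δ₁ β₂ → _≺_ R β₁ δ₂ → _≺_ R δ₂ β₂ →
    _≺_ R β₁ δ₁′ → _≺_ R δ₁′ β₂ → _≺_ R β₁ δ₂′ → _≺_ R δ₂′ β₂ →
    PairEq δ₁ δ₂ δ₁′ δ₂′)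

corollary4p6 R I AI β₁ β₂ γ₁ γ₂ β₁∈I β₂∈I γ₁∈I γ₂∈I β₁+β₂≡γ₁+γ₂ β₁≺γ₁ γ₁≺β₂ _ _ =
  (λ β₁′ β₂′ β₁′∈I β₂′∈I ne β₁′+β₂′≡γ₁+γ₂ β₁′≺γ₁ γ₁≺β₂′ _ _ →
    same-sum-ordered-pairs-nested R AI β₁∈I β₂∈I β₁′∈I β₂′∈I (trans β₁+β₂≡γ₁+γ₂ (sym β₁′+β₂′≡γ₁+γ₂))
      (ne ∘ PairEq-sym) (≺-trans R β₁≺γ₁ γ₁≺β₂) (≺-trans R β₁′≺γ₁ γ₁≺β₂′))
  , (λ γ₁′ γ₂′ γ₁′∈Φ⁺ γ₂′∈Φ⁺ ne γ₁′+γ₂′≡β₁+β₂ β₁≺γ₁′ _ β₁≺γ₂′ _ →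
    same-sum-pairs-nested R AI γ₁∈I γ₂∈I (above-β₁ γ₁′∈Φ⁺ β₁≺γ₁′) (above-β₁ γ₂′∈Φ⁺ β₁≺γ₂′)
      (sym (trans γ₁′+γ₂′≡β₁+β₂ β₁+β₂≡γ₁+γ₂)) (ne ∘ PairEq-sym))
  , (λ δ₁ δ₂ δ₁′ δ₂′ δ₁∈Φ⁺ δ₂∈Φ⁺ δ₁′∈Φ⁺ δ₂′∈Φ⁺ δ₁⋠δ₂ δ₂⋠δ₁ δ₁′⋠δ₂′ δ₂′⋠δ₁′ δ₁+δ₂≡β₁+β₂ δ₁′+δ₂′≡β₁+β₂
       β₁≺δ₁ _ β₁≺δ₂ _ β₁≺δ₁′ _ β₁≺δ₂′ _ →
    same-sum-incomparable-pairs-equal R AI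
      (above-β₁ δ₁∈Φ⁺ β₁≺δ₁) (above-β₁ δ₂∈Φ⁺ β₁≺δ₂) (above-β₁ δ₁′∈Φ⁺ β₁≺δ₁′) (above-β₁ δ₂′∈Φ⁺ β₁≺δ₂′)
      δ₁⋠δ₂ δ₂⋠δ₁ δ₁′⋠δ₂′ δ₂′⋠δ₁′ (trans δ₁+δ₂≡β₁+β₂ (sym δ₁′+δ₂′≡β₁+β₂)))
  where
  above-β₁ : ∀ {γ} → Φ⁺ R γ → _≺_ R β₁ γ → I γ
  above-β₁ γ∈Φ⁺ β₁≺γ = AbelianIdeal.upward AI β₁∈I γ∈Φ⁺ (proj₁ β₁≺γ)
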